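{- Let $G_1$ and $G_2$ be simple connected graphs on $n_1$ and $n_2$ vertices, with signless Laplacians $Q_1,Q_2$, and let $G=G_1\circ G_2$ be their corona, with signless Laplacian $Q$. Then, as an identity of rational functions in $\lambda$, \[ f_Q (\lambda ) = (f_{Q_2 } (\lambda - 1))^{n_1 } f_{Q_1}\left(\lambda - n_2 + 1 -( - 1)^{n_2} \frac{f_{\overline{Q_2} }\left( n_2 - \lambda -1 \right)}{f_{Q_2} (\lambda-1 )}\right). \]
   Context: For a simple graph $H$ on $m$ vertices, $Q(H)=D(H)+A(H)$ is its signless Laplacian (degree diagonal matrix plus adjacency matrix). $f_Q(\lambda)=\det(\lambda I-Q)$ for $Q=Q(G)$, $f_{Q_i}(\lambda)=\det(\lambda I_{n_i}-Q_i)$, and $f_{\overline{Q_2}}(\lambda)=\det(\lambda I_{n_2}-Q(\overline{G_2}))$ where $\overline{G_2}$ is the complement of $G_2$. The corona $G_1\circ G_2$ is obtained by taking one copy of $G_1$ and $n_1$ disjoint copies of $G_2$, and joining the $i$-th vertex of $G_1$ by an edge to every vertex of the $i$-th copy of $G_2$, for $i=1,\dots,n_1$. -}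

module Defs where

open import Data.Bool using (Bool; true; false; not; _∧_; if_then_else_)
open import Data.Nat as ℕ using (ℕ; zero; suc)
open import Data.Fin using (Fin; zero; suc; splitAt; quotRem; punchIn)
import Data.Fin as F
open import Data.Sum using (_⊎_; inj₁; inj₂)
open import Data.Product using (_×_; _,_; proj₁; proj₂; ∃)
open import Data.Integer using (+_)
open import Data.Rational using (ℚ; 0ℚ; 1ℚ; _+_; _-_; _*_; -_; _÷_; ≢-nonZero)
open import Relation.Binary.PropositionalEquality using (_≡_; _≢_)
open import Relation.Nullary.Decidable using (⌊_⌋)

record SimpleGraph (n : ℕ) : Set where
  field
    adj    : Fin n → Fin n → Bool
    sym    : ∀ i j → adj i j ≡ adj j i
    irrefl : ∀ i → adj i i ≡ false
open SimpleGraph public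

data Reach {n : ℕ} (G : SimpleGraph n) : Fin n → Fin n → Set where
  here : ∀ {i} → Reach G i i
  step : ∀ {i j k} → adj G i j ≡ true → Reach G j k → Reach G i k

Connected : ∀ {n} → SimpleGraph n → Set
Connected {n} G = ℕ.NonZero n × (∀ i j → Reach G i j)

_==_ : ∀ {n} → Fin n → Fin n → Bool
i == j = ⌊ i F.≟ j ⌋

complAdj : ∀ {n} → SimpleGraph n → Fin n → Fin n → Bool
complAdj G i j = not (adj G i j) ∧ not (i == j)

-- The first n1 vertices are those of G1; a vertex x of the remaining
-- block Fin (n1 * n2) with quotRem n2 x = (j , i) is vertex j of the
-- i-th copy of G2.

coronaAdj : ∀ {n₁ n₂} → SimpleGraph n₁ → SimpleGraph n₂ →
            Fin (n₁ ℕ.+ n₁ ℕ.* n₂) → Fin (n₁ ℕ.+ n₁ ℕ.* n₂) → Bool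
coronaAdj {n₁} {n₂} G₁ G₂ u v with splitAt n₁ u | splitAt n₁ v
... | inj₁ a | inj₁ b = adj G₁ a b
... | inj₁ a | inj₂ y = a == copy y
  where copy : Fin (n₁ ℕ.* n₂) → Fin n₁
        copy z = proj₂ (quotRem {n₁} n₂ z)
... | inj₂ x | inj₁ b = copy x == b
  where copy : Fin (n₁ ℕ.* n₂) → Fin n₁
        copy z = proj₂ (quotRem {n₁} n₂ z)
... | inj₂ x | inj₂ y =
      (proj₂ (quotRem {n₁} n₂ x) == proj₂ (quotRem {n₁} n₂ y))
        ∧ adj G₂ (proj₁ (quotRem {n₁} n₂ x)) (proj₁ (quotRem {n₁} n₂ y))

Matrix : ℕ → Set
Matrix n = Fin n → Fin n → ℚ

sumℚ : ∀ {n} → (Fin n → ℚ) → ℚ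
sumℚ {zero}  f = 0ℚ
sumℚ {suc n} f = f zero + sumℚ (λ i → f (suc i))

sign : ℕ → ℚ
sign zero    = 1ℚ
sign (suc k) = - sign k

det : ∀ {n} → Matrix n → ℚ
det {zero}  M = 1ℚ
det {suc n} M =
  sumℚ (λ j → sign (F.toℕ j) * M zero j * det (λ r c → M (suc r) (punchIn j c)))

b2q : Bool → ℚ
b2q true  = 1ℚ
b2q false = 0ℚ

degree : ∀ {n} → (Fin n → Fin n → Bool) → Fin n → ℚ
degree A i = sumℚ (λ j → b2q (A i j))

signlessLaplacian : ∀ {n} → (Fin n → Fin n → Bool) → Matrix n
signlessLaplacian A i j = if i == j then degree A i else b2q (A i j)

charPoly : ∀ {n} → Matrix n → ℚ → ℚ
charPoly M λ' = det (λ i j → (if i == j then λ' else 0ℚ) - M i j)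

ℕtoℚ : ℕ → ℚ
ℕtoℚ k = + k Data.Rational./ 1

_^ℚ_ : ℚ → ℕ → ℚ
x ^ℚ zero  = 1ℚ
x ^ℚ suc k = x * (x ^ℚ k)

divBy : (p q : ℚ) → q ≢ 0ℚ → ℚ
divBy p q nz = _÷_ p q {{≢-nonZero nz}}

module Submission where

-- Order the vertices of G₁ ∘ G₂ as those of G₁ followed by the n₁ copies of G₂.  Then
-- λI − Q is a block matrix whose lower right block is block diagonal with n₁ copies of
-- P = (λ − 1)I − Q₂, and whose off-diagonal blocks are minus the incidence between a
-- vertex i of G₁ and the vertices of the i-th copy.  Adding to each top row the
-- combination of bottom rows with coefficients 𝟙ᵀP⁻¹ (Cramer's rule) clears the upper
-- right block and leaves (λ − n₂ − 𝟙ᵀP⁻¹𝟙)I − Q₁ on the diagonal (Schur complement), so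
-- f_Q(λ) = det(P)^n₁ · f_Q₁(λ − n₂ − 𝟙ᵀP⁻¹𝟙).  Finally Q(Ḡ₂) = (n₂ − 2)I + J − Q₂, so
-- (n₂ − λ − 1)I − Q(Ḡ₂) = −(P + J), and the matrix determinant lemma for the rank-one
-- matrix J gives f_Q̄₂(n₂ − λ − 1) = (−1)^n₂ det P (1 + 𝟙ᵀP⁻¹𝟙).

open import Defs hiding (sym; step)
open import Data.Nat as ℕ using (ℕ; zero; suc)
open import Data.Fin as F using (Fin; zero; suc; punchIn; toℕ; _↑ˡ_; _↑ʳ_; combine; quotient; remainder; remQuot)
import Data.Fin.Properties as FP
open import Data.Vec.Functional using (_∷_; _++_)
open import Data.Vec.Functional.Properties using (lookup-++ˡ; lookup-++ʳ)
open import Data.Bool using (Bool; true; false; if_then_else_; not; _∧_)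
open import Data.Rational using (ℚ; 0ℚ; 1ℚ; _+_; _-_; _*_; -_; ½; mkℚ; _/_; 1/_; ≢-nonZero)
import Data.Rational.Properties as QP
open import Data.Rational.Solver using (module +-*-Solver)
open import Data.Product using (proj₁; proj₂)
import Data.Product as Product
open import Data.Integer as ℤ using ()
import Data.Integer.Properties as ZP
import Data.Sign as Sign
import Data.Nat.Coprimality as Coprime
import Data.Nat.Properties as NP
open import Algebra.Bundles using (Ring)
import Algebra.Properties.Semiring.Sum as SemiringSum
open import Function using (_∘_; Injective)
open import Relation.Binary.PropositionalEquality
open import Relation.Nullary using (yes; no; contradiction)

open +-*-Solver

private module Σ = SemiringSum (Ring.semiring QP.+-*-ring)

==-refl : ∀ {n} (i : Fin n) → (i == i) ≡ true
==-refl i with i F.≟ i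
... | yes _ = refl
... | no i≢i = contradiction refl i≢i

==-≢ : ∀ {n} {i j : Fin n} → i ≢ j → (i == j) ≡ false
==-≢ {i = i} {j} i≢j with i F.≟ j
... | yes i≡j = contradiction i≡j i≢j
... | no _ = refl

==-sym : ∀ {n} (i j : Fin n) → (i == j) ≡ (j == i)
==-sym i j with i F.≟ j
... | yes refl = sym (==-refl i)
... | no i≢j = sym (==-≢ (i≢j ∘ sym))

==-injective : ∀ {m n} (f : Fin m → Fin n) → Injective _≡_ _≡_ f →
               ∀ i j → (f i == f j) ≡ (i == j)
==-injective f f-inj i j with i F.≟ j
... | yes refl = ==-refl (f i)
... | no i≢j = ==-≢ (i≢j ∘ f-inj)

==-suc : ∀ {n} (i j : Fin n) → (suc i == suc j) ≡ (i == j)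
==-suc = ==-injective suc FP.suc-injective

==-↑ˡ : ∀ {a} b (i j : Fin a) → ((i ↑ˡ b) == (j ↑ˡ b)) ≡ (i == j)
==-↑ˡ b = ==-injective (_↑ˡ b) (FP.↑ˡ-injective b _ _)

==-↑ʳ : ∀ a {b} (x y : Fin b) → ((a ↑ʳ x) == (a ↑ʳ y)) ≡ (x == y)
==-↑ʳ a = ==-injective (a ↑ʳ_) (FP.↑ʳ-injective a _ _)

↑ˡ≢↑ʳ : ∀ {a b} (i : Fin a) (y : Fin b) → i ↑ˡ b ≢ a ↑ʳ y
↑ˡ≢↑ʳ zero y ()
↑ˡ≢↑ʳ (suc i) y eq = ↑ˡ≢↑ʳ i y (FP.suc-injective eq)

sumℚ-cong : ∀ {n} {f g : Fin n → ℚ} → (∀ i → f i ≡ g i) → sumℚ f ≡ sumℚ g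
sumℚ-cong {zero} eq = refl
sumℚ-cong {suc n} eq = cong₂ _+_ (eq zero) (sumℚ-cong (eq ∘ suc))

sumℚ≡sum : ∀ {n} (f : Fin n → ℚ) → sumℚ f ≡ Σ.sum f
sumℚ≡sum {zero} f = refl
sumℚ≡sum {suc n} f = cong (f zero +_) (sumℚ≡sum (f ∘ suc))

sumℚ-distrib-+ : ∀ {n} (f g : Fin n → ℚ) → sumℚ (λ i → f i + g i) ≡ sumℚ f + sumℚ g
sumℚ-distrib-+ f g = begin
  sumℚ (λ i → f i + g i)  ≡⟨ sumℚ≡sum (λ i → f i + g i) ⟩
  Σ.sum (λ i → f i + g i) ≡⟨ Σ.∑-distrib-+ f g ⟩
  Σ.sum f + Σ.sum g       ≡⟨ sym (cong₂ _+_ (sumℚ≡sum f) (sumℚ≡sum g)) ⟩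
  sumℚ f + sumℚ g         ∎
  where open ≡-Reasoning

*-distribˡ-sumℚ : ∀ {n} (c : ℚ) (f : Fin n → ℚ) → c * sumℚ f ≡ sumℚ (λ i → c * f i)
*-distribˡ-sumℚ c f = begin
  c * sumℚ f              ≡⟨ cong (c *_) (sumℚ≡sum f) ⟩
  c * Σ.sum f             ≡⟨ Σ.*-distribˡ-sum c f ⟩
  Σ.sum (λ i → c * f i)   ≡⟨ sym (sumℚ≡sum (λ i → c * f i)) ⟩
  sumℚ (λ i → c * f i)    ∎
  where open ≡-Reasoning

*-distribʳ-sumℚ : ∀ {n} (c : ℚ) (f : Fin n → ℚ) → sumℚ f * c ≡ sumℚ (λ i → f i * c)
*-distribʳ-sumℚ c f = begin
  sumℚ f * c              ≡⟨ cong (_* c) (sumℚ≡sum f) ⟩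
  Σ.sum f * c             ≡⟨ Σ.*-distribʳ-sum c f ⟩
  Σ.sum (λ i → f i * c)   ≡⟨ sym (sumℚ≡sum (λ i → f i * c)) ⟩
  sumℚ (λ i → f i * c)    ∎
  where open ≡-Reasoning

sumℚ-comm : ∀ {m n} (f : Fin m → Fin n → ℚ) →
            sumℚ (λ i → sumℚ (f i)) ≡ sumℚ (λ j → sumℚ (λ i → f i j))
sumℚ-comm f = begin
  sumℚ (λ i → sumℚ (f i))               ≡⟨ sumℚ-cong (sumℚ≡sum ∘ f) ⟩
  sumℚ (λ i → Σ.sum (f i))              ≡⟨ sumℚ≡sum (λ i → Σ.sum (f i)) ⟩
  Σ.sum (λ i → Σ.sum (f i))             ≡⟨ Σ.∑-comm f ⟩
  Σ.sum (λ j → Σ.sum (λ i → f i j))     ≡⟨ sym (sumℚ≡sum (λ j → Σ.sum (λ i → f i j))) ⟩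
  sumℚ (λ j → Σ.sum (λ i → f i j))      ≡⟨ sym (sumℚ-cong (λ j → sumℚ≡sum (λ i → f i j))) ⟩
  sumℚ (λ j → sumℚ (λ i → f i j))       ∎
  where open ≡-Reasoning

sumℚ-linear : ∀ {n} (a : ℚ) (f g : Fin n → ℚ) →
              sumℚ (λ i → f i + a * g i) ≡ sumℚ f + a * sumℚ g
sumℚ-linear a f g =
  trans (sumℚ-distrib-+ f (λ i → a * g i)) (cong (sumℚ f +_) (sym (*-distribˡ-sumℚ a g)))

sumℚ-zero : ∀ {n} (f : Fin n → ℚ) → (∀ i → f i ≡ 0ℚ) → sumℚ f ≡ 0ℚ
sumℚ-zero {zero} f eq = refl
sumℚ-zero {suc n} f eq = trans (cong₂ _+_ (eq zero) (sumℚ-zero (f ∘ suc) (eq ∘ suc))) (QP.+-identityˡ 0ℚ)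

sumℚ-neg : ∀ {n} (f : Fin n → ℚ) → sumℚ (λ i → - f i) ≡ - sumℚ f
sumℚ-neg {zero} f = refl
sumℚ-neg {suc n} f =
  trans (cong (- f zero +_) (sumℚ-neg (f ∘ suc))) (sym (QP.neg-distrib-+ (f zero) _))

sumℚ-↑ : ∀ m {n} (f : Fin (m ℕ.+ n) → ℚ) →
         sumℚ f ≡ sumℚ (λ i → f (i ↑ˡ n)) + sumℚ (λ j → f (m ↑ʳ j))
sumℚ-↑ zero f = sym (QP.+-identityˡ (sumℚ f))
sumℚ-↑ (suc m) f =
  trans (cong (f zero +_) (sumℚ-↑ m (f ∘ suc))) (sym (QP.+-assoc (f zero) _ _))

sumℚ-combine : ∀ a {b} (f : Fin (a ℕ.* b) → ℚ) →
               sumℚ f ≡ sumℚ {a} (λ i → sumℚ {b} (λ j → f (combine i j)))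
sumℚ-combine zero f = refl
sumℚ-combine (suc a) {b} f =
  trans (sumℚ-↑ b f) (cong (sumℚ (λ j → f (j ↑ˡ (a ℕ.* b))) +_) (sumℚ-combine a (λ y → f (b ↑ʳ y))))

sumℚ-delta : ∀ {n} (i : Fin n) (f : Fin n → ℚ) →
             sumℚ (λ k → if k == i then f k else 0ℚ) ≡ f i
sumℚ-delta {suc n} zero f = trans (cong (f zero +_) (sumℚ-zero {n} (λ _ → 0ℚ) (λ _ → refl))) (QP.+-identityʳ (f zero))
sumℚ-delta {suc n} (suc i) f = begin
  0ℚ + sumℚ (λ k → if suc k == suc i then f (suc k) else 0ℚ)
    ≡⟨ QP.+-identityˡ _ ⟩
  sumℚ (λ k → if suc k == suc i then f (suc k) else 0ℚ)
    ≡⟨ sumℚ-cong (λ k → cong (if_then f (suc k) else 0ℚ) (==-suc k i)) ⟩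
  sumℚ (λ k → if k == i then f (suc k) else 0ℚ)
    ≡⟨ sumℚ-delta i (f ∘ suc) ⟩
  f (suc i) ∎
  where open ≡-Reasoning

quotient-combine : ∀ {a b} (i : Fin a) (j : Fin b) → quotient {a} b (combine i j) ≡ i
quotient-combine i j = cong proj₁ (FP.remQuot-combine i j)

remainder-combine : ∀ {a b} (i : Fin a) (j : Fin b) → remainder {a} b (combine i j) ≡ j
remainder-combine i j = cong proj₂ (FP.remQuot-combine i j)

sumℚ-quotient : ∀ a {b} (i : Fin a) (f : Fin (a ℕ.* b) → ℚ) →
                sumℚ (λ x → if quotient {a} b x == i then f x else 0ℚ) ≡ sumℚ {b} (λ j → f (combine i j))
sumℚ-quotient a {b} i f = begin
  sumℚ (λ x → if quotient {a} b x == i then f x else 0ℚ)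
    ≡⟨ sumℚ-combine a _ ⟩
  sumℚ {a} (λ i' → sumℚ {b} (λ j → if quotient {a} b (combine i' j) == i then f (combine i' j) else 0ℚ))
    ≡⟨ sumℚ-cong (λ i' → sumℚ-cong (λ j → cong (λ k → if k == i then f (combine i' j) else 0ℚ) (quotient-combine i' j))) ⟩
  sumℚ {a} (λ i' → sumℚ {b} (λ j → if i' == i then f (combine i' j) else 0ℚ))
    ≡⟨ sumℚ-cong (λ i' → pull (i' == i) (λ j → f (combine i' j))) ⟩
  sumℚ (λ i' → if i' == i then sumℚ (λ j → f (combine i' j)) else 0ℚ)
    ≡⟨ sumℚ-delta i _ ⟩
  sumℚ {b} (λ j → f (combine i j)) ∎
  where
    open ≡-Reasoning
    pull : ∀ e (g : Fin b → ℚ) → sumℚ (λ j → if e then g j else 0ℚ) ≡ (if e then sumℚ g else 0ℚ)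
    pull true g = refl
    pull false g = sumℚ-zero {b} (λ _ → 0ℚ) (λ _ → refl)

sgn : ∀ {n} → Fin n → ℚ
sgn i = sign (toℕ i)

sign²≡1 : ∀ n → sign n * sign n ≡ 1ℚ
sign²≡1 zero = refl
sign²≡1 (suc n) = trans (solve 1 (λ x → (:- x) :* (:- x) := x :* x) refl (sign n)) (sign²≡1 n)

minor : ∀ {n} → Matrix (suc n) → Fin (suc n) → Matrix n
minor M j r c = M (suc r) (punchIn j c)

det-cong : ∀ {n} {M N : Matrix n} → (∀ r c → M r c ≡ N r c) → det M ≡ det N
det-cong {zero} eq = refl
det-cong {suc n} eq = sumℚ-cong (λ j →
  cong₂ _*_ (cong (sgn j *_) (eq zero j)) (det-cong (λ r c → eq (suc r) (punchIn j c))))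

det-neg : ∀ {n} (M : Matrix n) → det (λ r c → - M r c) ≡ sign n * det M
det-neg {zero} M = sym (QP.*-identityˡ 1ℚ)
det-neg {suc n} M = begin
  sumℚ (λ j → sgn j * (- M zero j) * det (λ r c → - minor M j r c))
    ≡⟨ sumℚ-cong (λ j → cong (sgn j * (- M zero j) *_) (det-neg (minor M j))) ⟩
  sumℚ (λ j → sgn j * (- M zero j) * (sign n * det (minor M j)))
    ≡⟨ sumℚ-cong (λ j → solve 4 (λ s m t d → s :* (:- m) :* (t :* d) := (:- t) :* (s :* m :* d))
                                 refl (sgn j) (M zero j) (sign n) (det (minor M j))) ⟩
  sumℚ (λ j → (- sign n) * (sgn j * M zero j * det (minor M j)))
    ≡⟨ sym (*-distribˡ-sumℚ (- sign n) (λ j → sgn j * M zero j * det (minor M j))) ⟩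
  (- sign n) * det M ∎
  where open ≡-Reasoning

-- Expanding det along its first two rows picks a column j for row 0 and then a column
-- k of the remaining ones for row 1; (j , k) ↦ (punchIn j k , swapPunch j k) exchanges
-- the two chosen columns, which is why swapping the two rows negates det.

swapPunch : ∀ {n} → Fin (suc n) → Fin n → Fin n
swapPunch {suc n} zero    k       = zero
swapPunch {suc n} (suc j) zero    = j
swapPunch {suc n} (suc j) (suc k) = suc (swapPunch j k)

punchIn-swapPunch : ∀ {n} (j : Fin (suc n)) (k : Fin n) → punchIn (punchIn j k) (swapPunch j k) ≡ j
punchIn-swapPunch {suc n} zero    k       = refl
punchIn-swapPunch {suc n} (suc j) zero    = refl
punchIn-swapPunch {suc n} (suc j) (suc k) = cong suc (punchIn-swapPunch j k)

punchIn²-swapPunch : ∀ {n} (j : Fin (suc (suc n))) (k : Fin (suc n)) (c : Fin n) →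
                     punchIn (punchIn j k) (punchIn (swapPunch j k) c) ≡ punchIn j (punchIn k c)
punchIn²-swapPunch zero    k       c = refl
punchIn²-swapPunch (suc j) zero    c = refl
punchIn²-swapPunch {suc n} (suc j) (suc k) zero    = refl
punchIn²-swapPunch {suc n} (suc j) (suc k) (suc c) = cong suc (punchIn²-swapPunch j k c)

sgn-swapPunch : ∀ {n} (j : Fin (suc n)) (k : Fin n) →
                sgn (punchIn j k) * sgn (swapPunch j k) ≡ - (sgn j * sgn k)
sgn-swapPunch {suc n} zero k = solve 1 (λ a → (:- a) :* con 1ℚ := :- (con 1ℚ :* a)) refl (sgn k)
sgn-swapPunch {suc n} (suc j) zero = solve 1 (λ a → con 1ℚ :* a := :- ((:- a) :* con 1ℚ)) refl (sgn j)
sgn-swapPunch {suc n} (suc j) (suc k) = begin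
  (- sgn (punchIn j k)) * (- sgn (swapPunch j k))
    ≡⟨ solve 2 (λ a b → (:- a) :* (:- b) := a :* b) refl (sgn (punchIn j k)) (sgn (swapPunch j k)) ⟩
  sgn (punchIn j k) * sgn (swapPunch j k)
    ≡⟨ sgn-swapPunch j k ⟩
  - (sgn j * sgn k)
    ≡⟨ cong -_ (solve 2 (λ a b → a :* b := (:- a) :* (:- b)) refl (sgn j) (sgn k)) ⟩
  - ((- sgn j) * (- sgn k)) ∎
  where open ≡-Reasoning

sumℚ-swapPunch : ∀ {n} (f : Fin (suc n) → Fin n → ℚ) →
                 sumℚ (λ j → sumℚ (f j)) ≡ sumℚ (λ j → sumℚ (λ k → f (punchIn j k) (swapPunch j k)))
sumℚ-swapPunch {zero} f = refl
sumℚ-swapPunch {suc n} f = begin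
  sumℚ (f zero) + sumℚ (λ j → f (suc j) zero + sumℚ (λ k → f (suc j) (suc k)))
    ≡⟨ cong (sumℚ (f zero) +_) (sumℚ-distrib-+ (λ j → f (suc j) zero) (λ j → sumℚ (f (suc j) ∘ suc))) ⟩
  sumℚ (f zero) + (sumℚ (λ j → f (suc j) zero) + sumℚ (λ j → sumℚ (f (suc j) ∘ suc)))
    ≡⟨ cong (λ z → sumℚ (f zero) + (sumℚ (λ j → f (suc j) zero) + z)) (sumℚ-swapPunch (λ j k → f (suc j) (suc k))) ⟩
  sumℚ (f zero) + (sumℚ (λ j → f (suc j) zero) + S)
    ≡⟨ solve 3 (λ a b c → a :+ (b :+ c) := b :+ (a :+ c)) refl (sumℚ (f zero)) (sumℚ (λ j → f (suc j) zero)) S ⟩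
  sumℚ (λ j → f (suc j) zero) + (sumℚ (f zero) + S)
    ≡⟨ cong (sumℚ (λ j → f (suc j) zero) +_)
         (sym (sumℚ-distrib-+ (f zero) (λ j → sumℚ (λ k → f (suc (punchIn j k)) (suc (swapPunch j k)))))) ⟩
  _ ∎
  where
    open ≡-Reasoning
    S = sumℚ (λ j → sumℚ (λ k → f (suc (punchIn j k)) (suc (swapPunch j k))))

module _ {n : ℕ} where

  laplace₂ : (a b : Fin (suc (suc n)) → ℚ) (R : Fin n → Fin (suc (suc n)) → ℚ) →
             Fin (suc (suc n)) → Fin (suc n) → ℚ
  laplace₂ a b R j k = sgn j * a j * (sgn k * b (punchIn j k) * det (λ r c → R r (punchIn j (punchIn k c))))

  det-laplace₂ : (M : Matrix (suc (suc n))) →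
                 det M ≡ sumℚ (λ j → sumℚ (laplace₂ (M zero) (M (suc zero)) (λ r → M (suc (suc r))) j))
  det-laplace₂ M = sumℚ-cong (λ j → *-distribˡ-sumℚ (sgn j * M zero j)
    (λ k → sgn k * M (suc zero) (punchIn j k) * det (λ r c → M (suc (suc r)) (punchIn j (punchIn k c)))))

  laplace₂-swap : ∀ a b R j k → laplace₂ b a R (punchIn j k) (swapPunch j k) ≡ - laplace₂ a b R j k
  laplace₂-swap a b R j k = begin
    sgn x * b x * (sgn k' * a (punchIn x k') * D x k')
      ≡⟨ cong₂ (λ u v → sgn x * b x * (sgn k' * a u * v)) (punchIn-swapPunch j k)
               (det-cong (λ r c → cong (R r) (punchIn²-swapPunch j k c))) ⟩
    sgn x * b x * (sgn k' * a j * D j k)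
      ≡⟨ solve 5 (λ p q u v w → p :* u :* (q :* v :* w) := (p :* q) :* (u :* v :* w))
                 refl (sgn x) (sgn k') (b x) (a j) (D j k) ⟩
    (sgn x * sgn k') * (b x * a j * D j k)
      ≡⟨ cong (_* (b x * a j * D j k)) (sgn-swapPunch j k) ⟩
    - (sgn j * sgn k) * (b x * a j * D j k)
      ≡⟨ solve 5 (λ p q u v w → (:- (p :* q)) :* (u :* v :* w) := :- (p :* v :* (q :* u :* w)))
                 refl (sgn j) (sgn k) (b x) (a j) (D j k) ⟩
    - (sgn j * a j * (sgn k * b x * D j k)) ∎
    where
      open ≡-Reasoning
      x = punchIn j k
      k' = swapPunch j k
      D : Fin (suc (suc n)) → Fin (suc n) → ℚ
      D j k = det (λ r c → R r (punchIn j (punchIn k c)))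

swap₀₁ : ∀ {n} → Fin (suc (suc n)) → Fin (suc (suc n))
swap₀₁ zero = suc zero
swap₀₁ (suc zero) = zero
swap₀₁ (suc (suc r)) = suc (suc r)

det-swap₀₁ : ∀ {n} (M : Matrix (suc (suc n))) → det (M ∘ swap₀₁) ≡ - det M
det-swap₀₁ M = begin
  det (M ∘ swap₀₁)
    ≡⟨ det-laplace₂ (M ∘ swap₀₁) ⟩
  sumℚ (λ j → sumℚ (laplace₂ b a R j))
    ≡⟨ sumℚ-swapPunch (laplace₂ b a R) ⟩
  sumℚ (λ j → sumℚ (λ k → laplace₂ b a R (punchIn j k) (swapPunch j k)))
    ≡⟨ sumℚ-cong (λ j → trans (sumℚ-cong (laplace₂-swap a b R j)) (sumℚ-neg (laplace₂ a b R j))) ⟩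
  sumℚ (λ j → - sumℚ (laplace₂ a b R j))
    ≡⟨ sumℚ-neg (λ j → sumℚ (laplace₂ a b R j)) ⟩
  - sumℚ (λ j → sumℚ (laplace₂ a b R j))
    ≡⟨ cong -_ (sym (det-laplace₂ M)) ⟩
  - det M ∎
  where
    open ≡-Reasoning
    a = M zero
    b = M (suc zero)
    R = λ r → M (suc (suc r))

x≡-x⇒x≡0 : ∀ (x : ℚ) → x ≡ - x → x ≡ 0ℚ
x≡-x⇒x≡0 x eq = begin
  x           ≡⟨ solve 1 (λ x → x := con ½ :* (x :+ x)) refl x ⟩
  ½ * (x + x) ≡⟨ cong (λ z → ½ * (x + z)) eq ⟩
  ½ * (x - x) ≡⟨ solve 1 (λ x → con ½ :* (x :- x) := con 0ℚ) refl x ⟩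
  0ℚ          ∎
  where open ≡-Reasoning

mutual
  det-duplicateRow₀ : ∀ {n} (M : Matrix (suc n)) (m : Fin n) →
                      (∀ k → M zero k ≡ M (suc m) k) → det M ≡ 0ℚ
  det-duplicateRow₀ {suc n} M zero eq = x≡-x⇒x≡0 (det M) (trans (det-cong swapped≡M) (det-swap₀₁ M))
    where
      swapped≡M : ∀ r c → M r c ≡ M (swap₀₁ r) c
      swapped≡M zero c = eq c
      swapped≡M (suc zero) c = sym (eq c)
      swapped≡M (suc (suc r)) c = refl
  det-duplicateRow₀ {suc n} M (suc m) eq = begin
    det M                    ≡⟨ solve 1 (λ x → x := :- (:- x)) refl (det M) ⟩
    - - det M                ≡⟨ cong -_ (sym (det-swap₀₁ M)) ⟩
    - det (M ∘ swap₀₁)       ≡⟨ cong -_ (det-duplicateRowₛ (M ∘ swap₀₁) zero (suc m) (λ ()) eq) ⟩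
    - 0ℚ                     ≡⟨⟩
    0ℚ                       ∎
    where open ≡-Reasoning

  det-duplicateRowₛ : ∀ {n} (M : Matrix (suc n)) (r r' : Fin n) → r ≢ r' →
                      (∀ k → M (suc r) k ≡ M (suc r') k) → det M ≡ 0ℚ
  det-duplicateRowₛ M r r' r≢r' eq = sumℚ-zero _ (λ j →
    trans (cong (sgn j * M zero j *_) (det-duplicateRow (minor M j) r r' r≢r' (λ k → eq (punchIn j k))))
          (QP.*-zeroʳ (sgn j * M zero j)))

  det-duplicateRow : ∀ {n} (M : Matrix n) (r r' : Fin n) → r ≢ r' →
                     (∀ k → M r k ≡ M r' k) → det M ≡ 0ℚ
  det-duplicateRow M zero    zero     r≢r' eq = contradiction refl r≢r'
  det-duplicateRow M zero    (suc m)  r≢r' eq = det-duplicateRow₀ M m eq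
  det-duplicateRow M (suc r) zero     r≢r' eq = det-duplicateRow₀ M r (sym ∘ eq)
  det-duplicateRow {suc n} M (suc r) (suc r') r≢r' eq =
    det-duplicateRowₛ M r r' (r≢r' ∘ cong suc) eq

setRow : ∀ {n} → Matrix n → Fin n → (Fin n → ℚ) → Matrix n
setRow M t v r k = if r == t then v k else M r k

setRow-self : ∀ {n} (M : Matrix n) (t r k : Fin n) → setRow M t (M t) r k ≡ M r k
setRow-self M t r k with r F.≟ t
... | yes refl = refl
... | no _ = refl

det-setRow-cong : ∀ {n} (M : Matrix n) (t : Fin n) {u v : Fin n → ℚ} → (∀ k → u k ≡ v k) →
                  det (setRow M t u) ≡ det (setRow M t v)
det-setRow-cong M t eq = det-cong (λ r k → cong (λ z → if r == t then z else M r k) (eq k))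

det-setRow-suc : ∀ {n} (M : Matrix (suc n)) (t : Fin n) (v : Fin (suc n) → ℚ) →
                 det (setRow M (suc t) v) ≡ sumℚ (λ j → sgn j * M zero j * det (setRow (minor M j) t (v ∘ punchIn j)))
det-setRow-suc M t v = sumℚ-cong (λ j → cong (sgn j * M zero j *_) (det-cong (λ r c →
  cong (λ b → if b then v (punchIn j c) else M (suc r) (punchIn j c)) (==-suc r t))))

det-setRow-linear : ∀ {n} (M : Matrix n) (t : Fin n) (a : ℚ) (u v : Fin n → ℚ) →
                    det (setRow M t (λ k → u k + a * v k)) ≡ det (setRow M t u) + a * det (setRow M t v)
det-setRow-linear {suc n} M zero a u v = trans
  (sumℚ-cong (λ j → solve 5 (λ s x y d a → s :* (x :+ a :* y) :* d := s :* x :* d :+ a :* (s :* y :* d))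
                            refl (sgn j) (u j) (v j) (det (minor M j)) a))
  (sumℚ-linear a (λ j → sgn j * u j * det (minor M j)) (λ j → sgn j * v j * det (minor M j)))
det-setRow-linear {suc n} M (suc t) a u v = begin
  det (setRow M (suc t) (λ k → u k + a * v k))
    ≡⟨ det-setRow-suc M t (λ k → u k + a * v k) ⟩
  sumℚ (λ j → c j * det (setRow (minor M j) t (λ k → u (punchIn j k) + a * v (punchIn j k))))
    ≡⟨ sumℚ-cong (λ j → cong (c j *_) (det-setRow-linear (minor M j) t a (u ∘ punchIn j) (v ∘ punchIn j))) ⟩
  sumℚ (λ j → c j * (U j + a * V j))
    ≡⟨ sumℚ-cong (λ j → solve 4 (λ c x y a → c :* (x :+ a :* y) := c :* x :+ a :* (c :* y)) refl (c j) (U j) (V j) a) ⟩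
  sumℚ (λ j → c j * U j + a * (c j * V j))
    ≡⟨ sumℚ-linear a (λ j → c j * U j) (λ j → c j * V j) ⟩
  sumℚ (λ j → c j * U j) + a * sumℚ (λ j → c j * V j)
    ≡⟨ sym (cong₂ (λ x y → x + a * y) (det-setRow-suc M t u) (det-setRow-suc M t v)) ⟩
  det (setRow M (suc t) u) + a * det (setRow M (suc t) v) ∎
  where
    open ≡-Reasoning
    c U V : Fin (suc n) → ℚ
    c j = sgn j * M zero j
    U j = det (setRow (minor M j) t (u ∘ punchIn j))
    V j = det (setRow (minor M j) t (v ∘ punchIn j))

det-setRow-+-∑ : ∀ {n p} (M : Matrix n) (t : Fin n) (u : Fin n → ℚ) (c : Fin p → ℚ) (V : Fin p → Fin n → ℚ) →
                 det (setRow M t (λ k → u k + sumℚ (λ s → c s * V s k)))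
                   ≡ det (setRow M t u) + sumℚ (λ s → c s * det (setRow M t (V s)))
det-setRow-+-∑ {p = zero} M t u c V =
  trans (det-setRow-cong M t (λ k → QP.+-identityʳ (u k))) (sym (QP.+-identityʳ _))
det-setRow-+-∑ {n} {suc p} M t u c V = begin
  det (setRow M t (λ k → u k + (c zero * V zero k + R k)))
    ≡⟨ det-setRow-cong M t (λ k → solve 4 (λ u c v r → u :+ (c :* v :+ r) := (u :+ r) :+ c :* v)
                                           refl (u k) (c zero) (V zero k) (R k)) ⟩
  det (setRow M t (λ k → (u k + R k) + c zero * V zero k))
    ≡⟨ det-setRow-linear M t (c zero) (λ k → u k + R k) (V zero) ⟩
  det (setRow M t (λ k → u k + R k)) + c zero * det (setRow M t (V zero))
    ≡⟨ cong (_+ c zero * det (setRow M t (V zero))) (det-setRow-+-∑ M t u (c ∘ suc) (V ∘ suc)) ⟩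
  (det (setRow M t u) + S) + c zero * det (setRow M t (V zero))
    ≡⟨ solve 3 (λ a s d → (a :+ s) :+ d := a :+ (d :+ s)) refl (det (setRow M t u)) S _ ⟩
  det (setRow M t u) + (c zero * det (setRow M t (V zero)) + S) ∎
  where
    open ≡-Reasoning
    R : Fin n → ℚ
    R k = sumℚ (λ s → c (suc s) * V (suc s) k)
    S = sumℚ (λ s → c (suc s) * det (setRow M t (V (suc s))))

det-addRowCombination : ∀ {n p} (M : Matrix n) (t : Fin n) (c : Fin p → ℚ) (σ : Fin p → Fin n) →
                        (∀ s → σ s ≢ t) →
                        det (setRow M t (λ k → M t k + sumℚ (λ s → c s * M (σ s) k))) ≡ det M
det-addRowCombination M t c σ σ≢t = begin
  det (setRow M t (λ k → M t k + sumℚ (λ s → c s * M (σ s) k)))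
    ≡⟨ det-setRow-+-∑ M t (M t) c (λ s → M (σ s)) ⟩
  det (setRow M t (M t)) + sumℚ (λ s → c s * det (setRow M t (M (σ s))))
    ≡⟨ cong₂ _+_ (det-cong (setRow-self M t)) (sumℚ-zero _ (λ s → trans (cong (c s *_) (duplicate s)) (QP.*-zeroʳ (c s)))) ⟩
  det M + 0ℚ
    ≡⟨ QP.+-identityʳ (det M) ⟩
  det M ∎
  where
    open ≡-Reasoning
    rows-equal : ∀ s k → setRow M t (M (σ s)) t k ≡ setRow M t (M (σ s)) (σ s) k
    rows-equal s k rewrite ==-refl t | ==-≢ (σ≢t s) = refl
    duplicate : ∀ s → det (setRow M t (M (σ s))) ≡ 0ℚ
    duplicate s = det-duplicateRow _ t (σ s) (σ≢t s ∘ sym) (rows-equal s)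

det-expandColumn₀ : ∀ {n} (M : Matrix (suc n)) →
                    det M ≡ sumℚ (λ i → sgn i * M i zero * det (λ r c → M (punchIn i r) (suc c)))
det-expandColumn₀ {zero} M = refl
det-expandColumn₀ {suc n} M = cong (X +_) (begin
  sumℚ (λ j → sgn (suc j) * M zero (suc j) * det (minor M (suc j)))
    ≡⟨ sumℚ-cong (λ j → cong (sgn (suc j) * M zero (suc j) *_) (det-expandColumn₀ (minor M (suc j)))) ⟩
  sumℚ (λ j → sgn (suc j) * M zero (suc j) * sumℚ (λ i → sgn i * M (suc i) zero * E i j))
    ≡⟨ sumℚ-cong (λ j → *-distribˡ-sumℚ (sgn (suc j) * M zero (suc j)) (λ i → sgn i * M (suc i) zero * E i j)) ⟩
  sumℚ (λ j → sumℚ (λ i → sgn (suc j) * M zero (suc j) * (sgn i * M (suc i) zero * E i j)))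
    ≡⟨ sumℚ-comm (λ j i → sgn (suc j) * M zero (suc j) * (sgn i * M (suc i) zero * E i j)) ⟩
  sumℚ (λ i → sumℚ (λ j → sgn (suc j) * M zero (suc j) * (sgn i * M (suc i) zero * E i j)))
    ≡⟨ sumℚ-cong (λ i → sumℚ-cong (λ j →
         solve 5 (λ a b c d e → (:- a) :* b :* (c :* d :* e) := (:- c) :* d :* (a :* b :* e))
               refl (sgn j) (M zero (suc j)) (sgn i) (M (suc i) zero) (E i j))) ⟩
  sumℚ (λ i → sumℚ (λ j → sgn (suc i) * M (suc i) zero * (sgn j * M zero (suc j) * E i j)))
    ≡⟨ sumℚ-cong (λ i → sym (*-distribˡ-sumℚ (sgn (suc i) * M (suc i) zero) (λ j → sgn j * M zero (suc j) * E i j))) ⟩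
  sumℚ (λ i → sgn (suc i) * M (suc i) zero * sumℚ (λ j → sgn j * M zero (suc j) * E i j)) ∎)
  where
    open ≡-Reasoning
    X = sgn {suc (suc n)} zero * M zero zero * det (λ r c → M (suc r) (suc c))
    E : Fin (suc n) → Fin (suc n) → ℚ
    E i j = det (λ r c → M (suc (punchIn i r)) (suc (punchIn j c)))

det-transpose : ∀ {n} (M : Matrix n) → det (λ r c → M c r) ≡ det M
det-transpose {zero} M = refl
det-transpose {suc n} M = trans
  (sumℚ-cong (λ j → cong (sgn j * M j zero *_) (det-transpose (λ r c → M (punchIn j r) (suc c)))))
  (sym (det-expandColumn₀ M))

det-moveToTop : ∀ {n} (m : Fin (suc n)) (M : Matrix (suc n)) → det (M m ∷ M ∘ punchIn m) ≡ sgn m * det M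
det-moveToTop zero M = sym (QP.*-identityˡ (det M))
det-moveToTop {suc n} (suc m) M = begin
  det X
    ≡⟨ solve 1 (λ x → x := :- (:- x)) refl (det X) ⟩
  - - det X
    ≡⟨ cong -_ (sym (det-swap₀₁ X)) ⟩
  - det (X ∘ swap₀₁)
    ≡⟨ cong -_ (sumℚ-cong (λ j → cong (sgn j * M zero j *_) (trans (det-cong (minor-swapped j)) (det-moveToTop m (minor M j))))) ⟩
  - sumℚ (λ j → sgn j * M zero j * (sgn m * det (minor M j)))
    ≡⟨ cong -_ (sumℚ-cong (λ j → solve 3 (λ a b c → a :* (b :* c) := b :* (a :* c))
                                        refl (sgn j * M zero j) (sgn m) (det (minor M j)))) ⟩
  - sumℚ (λ j → sgn m * (sgn j * M zero j * det (minor M j)))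
    ≡⟨ cong -_ (sym (*-distribˡ-sumℚ (sgn m) (λ j → sgn j * M zero j * det (minor M j)))) ⟩
  - (sgn m * det M)
    ≡⟨ solve 2 (λ a b → :- (a :* b) := (:- a) :* b) refl (sgn m) (det M) ⟩
  (- sgn m) * det M ∎
  where
    open ≡-Reasoning
    X = M (suc m) ∷ M ∘ punchIn (suc m)
    minor-swapped : ∀ j r c → minor (X ∘ swap₀₁) j r c ≡ (minor M j m ∷ minor M j ∘ punchIn m) r c
    minor-swapped j zero c = refl
    minor-swapped j (suc r) c = refl

cramer : ∀ {n} (P : Matrix n) (u : Fin n → ℚ) (l : Fin n) →
         sumℚ (λ j → P j l * det (setRow P j u)) ≡ u l * det P
cramer {suc n} P u l = begin
  S                  ≡⟨ solve 2 (λ s t → s := t :- (t :+ (:- s))) refl S t ⟩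
  t - (t + - S)      ≡⟨ cong (λ z → t - z) t-S≡0 ⟩
  t - 0ℚ             ≡⟨ QP.+-identityʳ t ⟩
  t                  ∎
  where
    open ≡-Reasoning
    S = sumℚ (λ j → P j l * det (setRow P j u))
    t = u l * det P
    rows : Fin (suc (suc n)) → Fin (suc n) → ℚ
    rows = u ∷ P
    -- Columns 0 and suc l of N coincide, and expanding det N along column 0 gives t − S.
    N : Matrix (suc (suc n))
    N r = rows r l ∷ rows r
    detN≡0 : det N ≡ 0ℚ
    detN≡0 = trans (sym (det-transpose N)) (det-duplicateRow (λ r c → N c r) zero (suc l) (λ ()) (λ k → refl))
    rows-without : ∀ j → det (rows ∘ punchIn (suc j)) ≡ sgn j * det (setRow P j u)
    rows-without j = trans (det-cong moved) (det-moveToTop j (setRow P j u))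
      where
        moved : ∀ r c → rows (punchIn (suc j) r) c ≡ (setRow P j u j ∷ setRow P j u ∘ punchIn j) r c
        moved zero c rewrite ==-refl j = refl
        moved (suc r) c rewrite ==-≢ (FP.punchInᵢ≢i j r) = refl
    term : ∀ j → - (P j l * det (setRow P j u)) ≡ (- sgn j) * P j l * det (rows ∘ punchIn (suc j))
    term j = begin
      - (P j l * D)
        ≡⟨ cong -_ (sym (trans (cong (_* (P j l * D)) (sign²≡1 (toℕ j))) (QP.*-identityˡ (P j l * D)))) ⟩
      - ((sgn j * sgn j) * (P j l * D))
        ≡⟨ solve 3 (λ s p d → :- ((s :* s) :* (p :* d)) := (:- s) :* p :* (s :* d)) refl (sgn j) (P j l) D ⟩
      (- sgn j) * P j l * (sgn j * D)
        ≡⟨ cong ((- sgn j) * P j l *_) (sym (rows-without j)) ⟩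
      (- sgn j) * P j l * det (rows ∘ punchIn (suc j)) ∎
      where D = det (setRow P j u)
    t-S≡0 : t + - S ≡ 0ℚ
    t-S≡0 = begin
      t + - S
        ≡⟨ cong₂ _+_ (cong (_* det P) (sym (QP.*-identityˡ (u l)))) (sym (sumℚ-neg (λ j → P j l * det (setRow P j u)))) ⟩
      1ℚ * u l * det P + sumℚ (λ j → - (P j l * det (setRow P j u)))
        ≡⟨ cong (1ℚ * u l * det P +_) (sumℚ-cong term) ⟩
      1ℚ * u l * det P + sumℚ (λ j → (- sgn j) * P j l * det (rows ∘ punchIn (suc j)))
        ≡⟨ sym (det-expandColumn₀ N) ⟩
      det N
        ≡⟨ detN≡0 ⟩
      0ℚ ∎

det-addToEveryRow : ∀ {n} (M : Matrix n) (e : Fin n → ℚ) →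
                    det (λ r c → M r c + e c) ≡ det M + sumℚ (λ t → det (setRow M t e))
det-addToEveryRow {zero} M e = refl
det-addToEveryRow {suc n} M e = begin
  sumℚ (λ c → sgn c * (M zero c + e c) * det (λ r k → minor M c r k + e (punchIn c k)))
    ≡⟨ sumℚ-cong (λ c → cong (sgn c * (M zero c + e c) *_) (det-addToEveryRow (minor M c) (e ∘ punchIn c))) ⟩
  sumℚ (λ c → sgn c * (M zero c + e c) * (det (minor M c) + T c))
    ≡⟨ sumℚ-cong (λ c → solve 5 (λ s m e d t → s :* (m :+ e) :* (d :+ t) := (s :* m :* d :+ s :* e :* d) :+ (s :* m :* t :+ s :* e :* t))
                                 refl (sgn c) (M zero c) (e c) (det (minor M c)) (T c)) ⟩
  sumℚ (λ c → (A c + B c) + (C c + D c))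
    ≡⟨ trans (sumℚ-distrib-+ (λ c → A c + B c) (λ c → C c + D c)) (cong₂ _+_ (sumℚ-distrib-+ A B) (sumℚ-distrib-+ C D)) ⟩
  (det M + det (setRow M zero e)) + (sumℚ C + sumℚ D)
    ≡⟨ cong (λ z → (det M + det (setRow M zero e)) + z) (cong₂ _+_ rows-suc duplicates) ⟩
  (det M + det (setRow M zero e)) + (sumℚ (λ j → det (setRow M (suc j) e)) + 0ℚ)
    ≡⟨ solve 3 (λ a b c → (a :+ b) :+ (c :+ con 0ℚ) := a :+ (b :+ c)) refl (det M) (det (setRow M zero e)) _ ⟩
  det M + sumℚ (λ t → det (setRow M t e)) ∎
  where
    open ≡-Reasoning
    T A B C D : Fin (suc n) → ℚ
    T c = sumℚ (λ j → det (setRow (minor M c) j (e ∘ punchIn c)))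
    A c = sgn c * M zero c * det (minor M c)
    B c = sgn c * e c * det (minor M c)
    C c = sgn c * M zero c * T c
    D c = sgn c * e c * T c
    rows-suc : sumℚ C ≡ sumℚ (λ j → det (setRow M (suc j) e))
    rows-suc = begin
      sumℚ C
        ≡⟨ sumℚ-cong (λ c → *-distribˡ-sumℚ (sgn c * M zero c) (λ j → det (setRow (minor M c) j (e ∘ punchIn c)))) ⟩
      sumℚ (λ c → sumℚ (λ j → sgn c * M zero c * det (setRow (minor M c) j (e ∘ punchIn c))))
        ≡⟨ sumℚ-comm (λ c j → sgn c * M zero c * det (setRow (minor M c) j (e ∘ punchIn c))) ⟩
      sumℚ (λ j → sumℚ (λ c → sgn c * M zero c * det (setRow (minor M c) j (e ∘ punchIn c))))
        ≡⟨ sumℚ-cong (λ j → sym (det-setRow-suc M j e)) ⟩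
      sumℚ (λ j → det (setRow M (suc j) e)) ∎
    rows-equal : ∀ j k → setRow (setRow M zero e) (suc j) e zero k ≡ setRow (setRow M zero e) (suc j) e (suc j) k
    rows-equal j k rewrite ==-refl (suc j) = refl
    duplicates : sumℚ D ≡ 0ℚ
    duplicates = begin
      sumℚ D
        ≡⟨ sumℚ-cong (λ c → *-distribˡ-sumℚ (sgn c * e c) (λ j → det (setRow (minor M c) j (e ∘ punchIn c)))) ⟩
      sumℚ (λ c → sumℚ (λ j → sgn c * e c * det (setRow (minor M c) j (e ∘ punchIn c))))
        ≡⟨ sumℚ-comm (λ c j → sgn c * e c * det (setRow (minor M c) j (e ∘ punchIn c))) ⟩
      sumℚ (λ j → sumℚ (λ c → sgn c * e c * det (setRow (minor M c) j (e ∘ punchIn c))))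
        ≡⟨ sumℚ-zero _ (λ j → trans (sym (det-setRow-suc (setRow M zero e) j e))
                                    (det-duplicateRow (setRow (setRow M zero e) (suc j) e) zero (suc j) (λ ()) (rows-equal j))) ⟩
      0ℚ ∎

punchIn-↑ˡ : ∀ {a} b (i : Fin (suc a)) (c : Fin a) → punchIn (i ↑ˡ b) (c ↑ˡ b) ≡ punchIn i c ↑ˡ b
punchIn-↑ˡ b zero c = refl
punchIn-↑ˡ b (suc i) zero = refl
punchIn-↑ˡ b (suc i) (suc c) = cong suc (punchIn-↑ˡ b i c)

punchIn-↑ʳ : ∀ a {b} (i : Fin (suc a)) (y : Fin b) → punchIn (i ↑ˡ b) (a ↑ʳ y) ≡ suc a ↑ʳ y
punchIn-↑ʳ a zero y = refl
punchIn-↑ʳ (suc a) (suc i) y = cong suc (punchIn-↑ʳ a i y)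

det-blockLowerTriangular : ∀ a {b} (M : Matrix (a ℕ.+ b)) → (∀ i y → M (i ↑ˡ b) (a ↑ʳ y) ≡ 0ℚ) →
  det M ≡ det (λ i i' → M (i ↑ˡ b) (i' ↑ˡ b)) * det (λ y y' → M (a ↑ʳ y) (a ↑ʳ y'))
det-blockLowerTriangular zero M upper≡0 = sym (QP.*-identityˡ (det M))
det-blockLowerTriangular (suc a) {b} M upper≡0 = begin
  sumℚ (λ j → sgn j * M zero j * det (minor M j))
    ≡⟨ sumℚ-↑ (suc a) (λ j → sgn j * M zero j * det (minor M j)) ⟩
  sumℚ (λ i → sgn (i ↑ˡ b) * M zero (i ↑ˡ b) * det (minor M (i ↑ˡ b)))
    + sumℚ (λ y → sgn (suc a ↑ʳ y) * M zero (suc a ↑ʳ y) * det (minor M (suc a ↑ʳ y)))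
    ≡⟨ cong₂ _+_ (sumℚ-cong left-column) (sumℚ-zero _ right-column) ⟩
  sumℚ (λ i → sgn i * A zero i * det (minor A i) * det D) + 0ℚ
    ≡⟨ QP.+-identityʳ _ ⟩
  sumℚ (λ i → sgn i * A zero i * det (minor A i) * det D)
    ≡⟨ sumℚ-cong (λ i → QP.*-comm (sgn i * A zero i * det (minor A i)) (det D)) ⟩
  sumℚ (λ i → det D * (sgn i * A zero i * det (minor A i)))
    ≡⟨ sym (*-distribˡ-sumℚ (det D) (λ i → sgn i * A zero i * det (minor A i))) ⟩
  det D * det A
    ≡⟨ QP.*-comm (det D) (det A) ⟩
  det A * det D ∎
  where
    open ≡-Reasoning
    A : Matrix (suc a)
    A i i' = M (i ↑ˡ b) (i' ↑ˡ b)
    D : Matrix b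
    D y y' = M (suc a ↑ʳ y) (suc a ↑ʳ y')
    right-column : ∀ y → sgn (suc a ↑ʳ y) * M zero (suc a ↑ʳ y) * det (minor M (suc a ↑ʳ y)) ≡ 0ℚ
    right-column y = begin
      sgn (suc a ↑ʳ y) * M zero (suc a ↑ʳ y) * det (minor M (suc a ↑ʳ y))
        ≡⟨ cong (λ z → sgn (suc a ↑ʳ y) * z * det (minor M (suc a ↑ʳ y))) (upper≡0 zero y) ⟩
      sgn (suc a ↑ʳ y) * 0ℚ * det (minor M (suc a ↑ʳ y))
        ≡⟨ solve 2 (λ s d → s :* con 0ℚ :* d := con 0ℚ) refl (sgn (suc a ↑ʳ y)) (det (minor M (suc a ↑ʳ y))) ⟩
      0ℚ ∎
    left-column : ∀ i → sgn (i ↑ˡ b) * M zero (i ↑ˡ b) * det (minor M (i ↑ˡ b))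
                        ≡ sgn i * A zero i * det (minor A i) * det D
    left-column i = begin
      sgn (i ↑ˡ b) * M zero (i ↑ˡ b) * det (minor M (i ↑ˡ b))
        ≡⟨ cong₂ (λ s d → s * M zero (i ↑ˡ b) * d) (cong sign (FP.toℕ-↑ˡ i b))
             (det-blockLowerTriangular a (minor M (i ↑ˡ b))
               (λ r y → trans (cong (M (suc (r ↑ˡ b))) (punchIn-↑ʳ a i y)) (upper≡0 (suc r) y))) ⟩
      sgn i * A zero i * (det (λ r c → minor M (i ↑ˡ b) (r ↑ˡ b) (c ↑ˡ b))
                           * det (λ y y' → minor M (i ↑ˡ b) (a ↑ʳ y) (a ↑ʳ y')))
        ≡⟨ cong₂ (λ u v → sgn i * A zero i * (u * v))
             (det-cong (λ r c → cong (M (suc (r ↑ˡ b))) (punchIn-↑ˡ b i c)))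
             (det-cong (λ y y' → cong (M (suc (a ↑ʳ y))) (punchIn-↑ʳ a i y'))) ⟩
      sgn i * A zero i * (det (minor A i) * det D)
        ≡⟨ sym (QP.*-assoc (sgn i * A zero i) (det (minor A i)) (det D)) ⟩
      sgn i * A zero i * det (minor A i) * det D ∎

det-addToTopRows : ∀ a {b} (Y : Fin (a ℕ.+ b) → Fin b → ℚ) (M : Matrix (a ℕ.+ b)) →
                   (∀ x y → Y (a ↑ʳ x) y ≡ 0ℚ) →
                   det (λ r c → M r c + sumℚ (λ y → Y r y * M (a ↑ʳ y) c)) ≡ det M
det-addToTopRows zero Y M Y≡0 = det-cong (λ r c →
  trans (cong (M r c +_) (sumℚ-zero _ (λ y → trans (cong (_* M y c) (Y≡0 r y)) (QP.*-zeroˡ (M y c)))))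
        (QP.+-identityʳ (M r c)))
det-addToTopRows (suc a) {b} Y M Y≡0 = begin
  det U
    ≡⟨ sumℚ-cong (λ j → cong (sgn j * U zero j *_) (det-addToTopRows a (Y ∘ suc) (minor M j) Y≡0)) ⟩
  det (setRow M zero (U zero))
    ≡⟨ det-addRowCombination M zero (Y zero) (suc a ↑ʳ_) (λ y ()) ⟩
  det M ∎
  where
    open ≡-Reasoning
    U : Matrix (suc a ℕ.+ b)
    U r c = M r c + sumℚ (λ y → Y r y * M (suc a ↑ʳ y) c)

det-schurComplement : ∀ a {b} (M : Matrix (a ℕ.+ b)) (X : Fin a → Fin b → ℚ) →
  (∀ i y → M (i ↑ˡ b) (a ↑ʳ y) + sumℚ (λ x → X i x * M (a ↑ʳ x) (a ↑ʳ y)) ≡ 0ℚ) →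
  det M ≡ det (λ i i' → M (i ↑ˡ b) (i' ↑ˡ b) + sumℚ (λ x → X i x * M (a ↑ʳ x) (i' ↑ˡ b)))
          * det (λ x y → M (a ↑ʳ x) (a ↑ʳ y))
det-schurComplement a {b} M X B+XD≡0 = begin
  det M
    ≡⟨ sym (det-addToTopRows a Y M (λ x y → cong (λ f → f y) (lookup-++ʳ X zeros x))) ⟩
  det U
    ≡⟨ det-blockLowerTriangular a U (λ i y → trans (U-top i (a ↑ʳ y)) (B+XD≡0 i y)) ⟩
  det (λ i i' → U (i ↑ˡ b) (i' ↑ˡ b)) * det (λ x y → U (a ↑ʳ x) (a ↑ʳ y))
    ≡⟨ cong₂ _*_ (det-cong (λ i i' → U-top i (i' ↑ˡ b))) (det-cong (λ x y → U-bottom x (a ↑ʳ y))) ⟩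
  det (λ i i' → M (i ↑ˡ b) (i' ↑ˡ b) + sumℚ (λ x → X i x * M (a ↑ʳ x) (i' ↑ˡ b)))
    * det (λ x y → M (a ↑ʳ x) (a ↑ʳ y)) ∎
  where
    open ≡-Reasoning
    zeros : Fin b → Fin b → ℚ
    zeros _ _ = 0ℚ
    Y : Fin (a ℕ.+ b) → Fin b → ℚ
    Y = X ++ zeros
    U : Matrix (a ℕ.+ b)
    U r c = M r c + sumℚ (λ y → Y r y * M (a ↑ʳ y) c)
    U-top : ∀ i c → U (i ↑ˡ b) c ≡ M (i ↑ˡ b) c + sumℚ (λ y → X i y * M (a ↑ʳ y) c)
    U-top i c = cong (λ f → M (i ↑ˡ b) c + sumℚ (λ y → f y * M (a ↑ʳ y) c)) (lookup-++ˡ X zeros i)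
    U-bottom : ∀ x c → U (a ↑ʳ x) c ≡ M (a ↑ʳ x) c
    U-bottom x c = begin
      U (a ↑ʳ x) c
        ≡⟨ cong (λ f → M (a ↑ʳ x) c + sumℚ (λ y → f y * M (a ↑ʳ y) c)) (lookup-++ʳ X zeros x) ⟩
      M (a ↑ʳ x) c + sumℚ (λ y → 0ℚ * M (a ↑ʳ y) c)
        ≡⟨ cong (M (a ↑ʳ x) c +_) (sumℚ-zero _ (λ y → QP.*-zeroˡ (M (a ↑ʳ y) c))) ⟩
      M (a ↑ʳ x) c + 0ℚ
        ≡⟨ QP.+-identityʳ _ ⟩
      M (a ↑ʳ x) c ∎

quotient-↑ˡ : ∀ {a} b (j : Fin b) → quotient {suc a} b (j ↑ˡ (a ℕ.* b)) ≡ zero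
quotient-↑ˡ b j = quotient-combine zero j

remainder-↑ˡ : ∀ {a} b (j : Fin b) → remainder {suc a} b (j ↑ˡ (a ℕ.* b)) ≡ j
remainder-↑ˡ b j = remainder-combine zero j

remQuot-↑ʳ : ∀ {a} b (y : Fin (a ℕ.* b)) → remQuot {suc a} b (b ↑ʳ y) ≡ Product.map₁ suc (remQuot {a} b y)
remQuot-↑ʳ {a} b y rewrite FP.splitAt-↑ʳ b (a ℕ.* b) y = refl

quotient-↑ʳ : ∀ {a} b (y : Fin (a ℕ.* b)) → quotient {suc a} b (b ↑ʳ y) ≡ suc (quotient {a} b y)
quotient-↑ʳ b y = cong proj₁ (remQuot-↑ʳ b y)

remainder-↑ʳ : ∀ {a} b (y : Fin (a ℕ.* b)) → remainder {suc a} b (b ↑ʳ y) ≡ remainder {a} b y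
remainder-↑ʳ b y = cong proj₂ (remQuot-↑ʳ b y)

quotient-remainder-injective : ∀ {a} b {x y : Fin (a ℕ.* b)} →
  quotient {a} b x ≡ quotient {a} b y → remainder {a} b x ≡ remainder {a} b y → x ≡ y
quotient-remainder-injective {a} b {x} {y} q≡ r≡ =
  trans (sym (FP.combine-remQuot {a} b x)) (trans (cong₂ combine q≡ r≡) (FP.combine-remQuot {a} b y))

blockDiagonal : ∀ a b → Matrix b → Matrix (a ℕ.* b)
blockDiagonal a b P x y =
  if quotient {a} b x == quotient {a} b y then P (remainder {a} b x) (remainder {a} b y) else 0ℚ

det-blockDiagonal : ∀ a b (P : Matrix b) → det (blockDiagonal a b P) ≡ det P ^ℚ a
det-blockDiagonal zero b P = refl
det-blockDiagonal (suc a) b P = begin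
  det (blockDiagonal (suc a) b P)
    ≡⟨ det-blockLowerTriangular b (blockDiagonal (suc a) b P) upper≡0 ⟩
  det (λ j j' → blockDiagonal (suc a) b P (j ↑ˡ (a ℕ.* b)) (j' ↑ˡ (a ℕ.* b)))
    * det (λ y y' → blockDiagonal (suc a) b P (b ↑ʳ y) (b ↑ʳ y'))
    ≡⟨ cong₂ _*_ (det-cong first-block) (trans (det-cong other-blocks) (det-blockDiagonal a b P)) ⟩
  det P * det P ^ℚ a ∎
  where
    open ≡-Reasoning
    upper≡0 : ∀ j y → blockDiagonal (suc a) b P (j ↑ˡ (a ℕ.* b)) (b ↑ʳ y) ≡ 0ℚ
    upper≡0 j y rewrite quotient-↑ˡ {a} b j | quotient-↑ʳ {a} b y = refl
    first-block : ∀ j j' → blockDiagonal (suc a) b P (j ↑ˡ (a ℕ.* b)) (j' ↑ˡ (a ℕ.* b)) ≡ P j j'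
    first-block j j' rewrite quotient-↑ˡ {a} b j | quotient-↑ˡ {a} b j'
                           | remainder-↑ˡ {a} b j | remainder-↑ˡ {a} b j' = refl
    other-blocks : ∀ y y' → blockDiagonal (suc a) b P (b ↑ʳ y) (b ↑ʳ y') ≡ blockDiagonal a b P y y'
    other-blocks y y' rewrite quotient-↑ʳ {a} b y | quotient-↑ʳ {a} b y'
                            | remainder-↑ʳ {a} b y | remainder-↑ʳ {a} b y'
                            | ==-suc (quotient {a} b y) (quotient {a} b y') = refl

onBlock : ∀ a {b} → Fin a → (Fin b → ℚ) → Fin (a ℕ.* b) → ℚ
onBlock a {b} i v x = if quotient {a} b x == i then v (remainder {a} b x) else 0ℚ

if-*ˡ : ∀ (e : Bool) (p q : ℚ) → (if e then p else 0ℚ) * q ≡ (if e then p * q else 0ℚ)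
if-*ˡ true p q = refl
if-*ˡ false p q = QP.*-zeroˡ q

sumℚ-onBlock : ∀ a {b} (i : Fin a) (v : Fin b → ℚ) (g : Fin (a ℕ.* b) → ℚ) →
               sumℚ (λ x → onBlock a i v x * g x) ≡ sumℚ (λ j → v j * g (combine i j))
sumℚ-onBlock a {b} i v g = begin
  sumℚ (λ x → onBlock a i v x * g x)
    ≡⟨ sumℚ-cong (λ x → if-*ˡ (quotient {a} b x == i) (v (remainder {a} b x)) (g x)) ⟩
  sumℚ (λ x → if quotient {a} b x == i then v (remainder {a} b x) * g x else 0ℚ)
    ≡⟨ sumℚ-quotient a i (λ x → v (remainder {a} b x) * g x) ⟩
  sumℚ (λ j → v (remainder {a} b (combine i j)) * g (combine i j))
    ≡⟨ sumℚ-cong (λ j → cong (λ r → v r * g (combine i j)) (remainder-combine i j)) ⟩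
  sumℚ (λ j → v j * g (combine i j)) ∎
  where open ≡-Reasoning

sumℚ-onBlock-quotient : ∀ a {b} (i : Fin a) (v : Fin b → ℚ) (h : Fin a → ℚ) →
                        sumℚ (λ x → onBlock a i v x * h (quotient {a} b x)) ≡ h i * sumℚ v
sumℚ-onBlock-quotient a {b} i v h = begin
  sumℚ (λ x → onBlock a i v x * h (quotient {a} b x))
    ≡⟨ sumℚ-onBlock a i v (h ∘ quotient {a} b) ⟩
  sumℚ (λ j → v j * h (quotient {a} b (combine i j)))
    ≡⟨ sumℚ-cong (λ j → trans (cong (λ q → v j * h q) (quotient-combine i j)) (QP.*-comm (v j) (h i))) ⟩
  sumℚ (λ j → h i * v j)
    ≡⟨ sym (*-distribˡ-sumℚ (h i) v) ⟩
  h i * sumℚ v ∎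
  where open ≡-Reasoning

sumℚ-onBlock-blockDiagonal : ∀ a {b} (P : Matrix b) (i : Fin a) (v : Fin b → ℚ) (y : Fin (a ℕ.* b)) →
  sumℚ (λ x → onBlock a i v x * blockDiagonal a b P x y)
    ≡ (if i == quotient {a} b y then sumℚ (λ j → v j * P j (remainder {a} b y)) else 0ℚ)
sumℚ-onBlock-blockDiagonal a {b} P i v y = begin
  sumℚ (λ x → onBlock a i v x * blockDiagonal a b P x y)
    ≡⟨ sumℚ-onBlock a i v (λ x → blockDiagonal a b P x y) ⟩
  sumℚ (λ j → v j * blockDiagonal a b P (combine i j) y)
    ≡⟨ sumℚ-cong (λ j → cong (v j *_) (entry j)) ⟩
  sumℚ (λ j → v j * (if i == quotient {a} b y then P j (remainder {a} b y) else 0ℚ))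
    ≡⟨ pull (i == quotient {a} b y) ⟩
  (if i == quotient {a} b y then sumℚ (λ j → v j * P j (remainder {a} b y)) else 0ℚ) ∎
  where
    open ≡-Reasoning
    entry : ∀ j → blockDiagonal a b P (combine i j) y ≡ (if i == quotient {a} b y then P j (remainder {a} b y) else 0ℚ)
    entry j rewrite quotient-combine {a} {b} i j | remainder-combine {a} {b} i j = refl
    pull : ∀ e → sumℚ (λ j → v j * (if e then P j (remainder {a} b y) else 0ℚ))
                 ≡ (if e then sumℚ (λ j → v j * P j (remainder {a} b y)) else 0ℚ)
    pull true = refl
    pull false = sumℚ-zero _ (λ j → QP.*-zeroʳ (v j))

charMatrix : ∀ {n} → Matrix n → ℚ → Matrix n
charMatrix M μ i j = (if i == j then μ else 0ℚ) - M i j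

charMatrix-shift : ∀ {n} (M : Matrix n) (μ κ : ℚ) (i j : Fin n) →
                   charMatrix M μ i j + (- b2q (i == j)) * κ ≡ charMatrix M (μ - κ) i j
charMatrix-shift M μ κ i j with i == j
... | true = solve 3 (λ μ m κ → (μ :- m) :+ (:- con 1ℚ) :* κ := (μ :- κ) :- m) refl μ (M i j) κ
... | false = trans (cong (0ℚ - M i j +_) (QP.*-zeroˡ κ)) (QP.+-identityʳ (0ℚ - M i j))

-- 𝟙ᵀ adj(P) 𝟙: replacing row t by 𝟙 sums the cofactors of row t.
sumAdjugate : ∀ {n} → Matrix n → ℚ
sumAdjugate P = sumℚ (λ t → det (setRow P t (λ _ → 1ℚ)))

-- The row vector 𝟙ᵀ P⁻¹, by Cramer's rule.
inverseColumnSums : ∀ {n} (P : Matrix n) → det P ≢ 0ℚ → Fin n → ℚ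
inverseColumnSums P nz j = divBy (det (setRow P j (λ _ → 1ℚ))) (det P) nz

inverseColumnSums-* : ∀ {n} (P : Matrix n) (nz : det P ≢ 0ℚ) (l : Fin n) →
                      sumℚ (λ j → inverseColumnSums P nz j * P j l) ≡ 1ℚ
inverseColumnSums-* {n} P nz l = begin
  sumℚ (λ j → W j * 1/ det P * P j l)
    ≡⟨ sumℚ-cong (λ j → solve 3 (λ w i p → w :* i :* p := i :* (p :* w)) refl (W j) (1/ det P) (P j l)) ⟩
  sumℚ (λ j → 1/ det P * (P j l * W j))
    ≡⟨ sym (*-distribˡ-sumℚ (1/ det P) (λ j → P j l * W j)) ⟩
  1/ det P * sumℚ (λ j → P j l * W j)
    ≡⟨ cong (1/ det P *_) (trans (cramer P (λ _ → 1ℚ) l) (QP.*-identityˡ (det P))) ⟩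
  1/ det P * det P
    ≡⟨ QP.*-inverseˡ (det P) ⟩
  1ℚ ∎
  where
    open ≡-Reasoning
    instance
      _ = ≢-nonZero nz
    W : Fin n → ℚ
    W j = det (setRow P j (λ _ → 1ℚ))

sumℚ-inverseColumnSums : ∀ {n} (P : Matrix n) (nz : det P ≢ 0ℚ) →
                         sumℚ (inverseColumnSums P nz) ≡ divBy (sumAdjugate P) (det P) nz
sumℚ-inverseColumnSums P nz = sym (*-distribʳ-sumℚ _ (λ t → det (setRow P t (λ _ → 1ℚ))))

ℕtoℚ≡mkℚ : ∀ n → ℕtoℚ n ≡ mkℚ (ℤ.+ n) 0 (Coprime.sym (Coprime.1-coprimeTo n))
ℕtoℚ≡mkℚ n = QP.normalize-coprime (Coprime.sym (Coprime.1-coprimeTo n))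

ℕtoℚ-suc : ∀ n → ℕtoℚ (suc n) ≡ 1ℚ + ℕtoℚ n
ℕtoℚ-suc n = trans (cong (_/ 1) numerator≡) (cong (1ℚ +_) (sym (ℕtoℚ≡mkℚ n)))
  where
    numerator≡ : ℤ.+ suc n ≡ ℤ.+ 1 ℤ.+ (Sign.+ ℤ.◃ n ℕ.* 1)
    numerator≡ = cong (λ z → ℤ.+ 1 ℤ.+ z) (sym (trans (ZP.+◃n≡+n (n ℕ.* 1)) (cong ℤ.+_ (NP.*-identityʳ n))))

sumℚ-one : ∀ n → sumℚ {n} (λ _ → 1ℚ) ≡ ℕtoℚ n
sumℚ-one zero = sym (ℕtoℚ≡mkℚ 0)
sumℚ-one (suc n) = trans (cong (1ℚ +_) (sumℚ-one n)) (sym (ℕtoℚ-suc n))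

b2q-if : ∀ b → b2q b ≡ (if b then 1ℚ else 0ℚ)
b2q-if true = refl
b2q-if false = refl

b2q-∧ : ∀ b c → b2q (b ∧ c) ≡ (if b then b2q c else 0ℚ)
b2q-∧ true c = refl
b2q-∧ false c = refl

degree-complAdj : ∀ {n} (G : SimpleGraph n) (j : Fin n) → degree (complAdj G) j ≡ ℕtoℚ n - 1ℚ - degree (adj G) j
degree-complAdj {n} G j = begin
  sumℚ (λ j' → b2q (complAdj G j j'))
    ≡⟨ sumℚ-cong entry ⟩
  sumℚ (λ j' → 1ℚ + (- b2q (adj G j j') + - (if j' == j then 1ℚ else 0ℚ)))
    ≡⟨ sumℚ-distrib-+ (λ _ → 1ℚ) (λ j' → - b2q (adj G j j') + - (if j' == j then 1ℚ else 0ℚ)) ⟩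
  sumℚ {n} (λ _ → 1ℚ) + sumℚ (λ j' → - b2q (adj G j j') + - (if j' == j then 1ℚ else 0ℚ))
    ≡⟨ cong₂ _+_ (sumℚ-one n) (sumℚ-distrib-+ (λ j' → - b2q (adj G j j')) (λ j' → - (if j' == j then 1ℚ else 0ℚ))) ⟩
  ℕtoℚ n + (sumℚ (λ j' → - b2q (adj G j j')) + sumℚ (λ j' → - (if j' == j then 1ℚ else 0ℚ)))
    ≡⟨ cong (λ z → ℕtoℚ n + z) (cong₂ _+_ (sumℚ-neg (b2q ∘ adj G j))
         (trans (sumℚ-neg (λ j' → if j' == j then 1ℚ else 0ℚ)) (cong -_ (sumℚ-delta j (λ _ → 1ℚ))))) ⟩
  ℕtoℚ n + (- degree (adj G) j + - 1ℚ)
    ≡⟨ solve 2 (λ n d → n :+ (:- d :+ :- con 1ℚ) := n :- con 1ℚ :- d) refl (ℕtoℚ n) (degree (adj G) j) ⟩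
  ℕtoℚ n - 1ℚ - degree (adj G) j ∎
  where
    open ≡-Reasoning
    entry : ∀ j' → b2q (complAdj G j j') ≡ 1ℚ + (- b2q (adj G j j') + - (if j' == j then 1ℚ else 0ℚ))
    entry j' with j' F.≟ j
    ... | yes refl rewrite irrefl G j' | ==-refl j' = refl
    ... | no j'≢j rewrite ==-≢ {i = j} {j'} (j'≢j ∘ sym) with adj G j j'
    ...   | true = refl
    ...   | false = refl

charPoly-complAdj : ∀ {n} (G : SimpleGraph n) (μ : ℚ) →
  charPoly (signlessLaplacian (complAdj G)) (ℕtoℚ n - μ - 1ℚ)
    ≡ sign n * (charPoly (signlessLaplacian (adj G)) (μ - 1ℚ) + sumAdjugate (charMatrix (signlessLaplacian (adj G)) (μ - 1ℚ)))
charPoly-complAdj {n} G μ = begin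
  det (charMatrix (signlessLaplacian (complAdj G)) (ℕtoℚ n - μ - 1ℚ))
    ≡⟨ det-cong (λ j j' → entry j j' (j == j')) ⟩
  det (λ r c → - (P r c + 1ℚ))
    ≡⟨ det-neg (λ r c → P r c + 1ℚ) ⟩
  sign n * det (λ r c → P r c + 1ℚ)
    ≡⟨ cong (sign n *_) (det-addToEveryRow P (λ _ → 1ℚ)) ⟩
  sign n * (det P + sumAdjugate P) ∎
  where
    open ≡-Reasoning
    P = charMatrix (signlessLaplacian (adj G)) (μ - 1ℚ)
    -- Both sides unfolded, with j == j' abstracted as q.
    entry : ∀ j j' q →
      (if q then ℕtoℚ n - μ - 1ℚ else 0ℚ) - (if q then degree (complAdj G) j else b2q (not (adj G j j') ∧ not q))
        ≡ - (((if q then μ - 1ℚ else 0ℚ) - (if q then degree (adj G) j else b2q (adj G j j'))) + 1ℚ)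
    entry j j' true = trans (cong (λ d → (ℕtoℚ n - μ - 1ℚ) - d) (degree-complAdj G j))
      (solve 3 (λ n l d → n :- l :- con 1ℚ :- (n :- con 1ℚ :- d) := :- ((l :- con 1ℚ :- d) :+ con 1ℚ))
             refl (ℕtoℚ n) μ (degree (adj G) j))
    entry j j' false with adj G j j'
    ... | true = refl
    ... | false = refl

divBy-charPoly-complAdj : ∀ {n} (G : SimpleGraph n) (μ : ℚ) →
  let P = charMatrix (signlessLaplacian (adj G)) (μ - 1ℚ) in (nz : det P ≢ 0ℚ) →
  sign n * divBy (charPoly (signlessLaplacian (complAdj G)) (ℕtoℚ n - μ - 1ℚ)) (det P) nz
    ≡ 1ℚ + divBy (sumAdjugate P) (det P) nz
divBy-charPoly-complAdj {n} G μ nz = begin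
  sign n * (charPoly (signlessLaplacian (complAdj G)) (ℕtoℚ n - μ - 1ℚ) * 1/ p)
    ≡⟨ cong (λ f → sign n * (f * 1/ p)) (charPoly-complAdj G μ) ⟩
  sign n * (sign n * (p + S) * 1/ p)
    ≡⟨ solve 4 (λ s p S i → s :* (s :* (p :+ S) :* i) := (s :* s) :* (p :* i :+ S :* i)) refl (sign n) p S (1/ p) ⟩
  (sign n * sign n) * (p * 1/ p + S * 1/ p)
    ≡⟨ cong₂ (λ a b → a * (b + S * 1/ p)) (sign²≡1 n) (QP.*-inverseʳ p) ⟩
  1ℚ * (1ℚ + S * 1/ p)
    ≡⟨ QP.*-identityˡ _ ⟩
  1ℚ + S * 1/ p ∎
  where
    open ≡-Reasoning
    p = charPoly (signlessLaplacian (adj G)) (μ - 1ℚ)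
    S = sumAdjugate (charMatrix (signlessLaplacian (adj G)) (μ - 1ℚ))
    instance
      _ = ≢-nonZero nz

module Corona {n₁ n₂ : ℕ} (G₁ : SimpleGraph n₁) (G₂ : SimpleGraph n₂) where

  private
    N : ℕ
    N = n₁ ℕ.* n₂

    C : Fin (n₁ ℕ.+ N) → Fin (n₁ ℕ.+ N) → Bool
    C = coronaAdj G₁ G₂

    copy : Fin N → Fin n₁
    copy = quotient {n₁} n₂

    index : Fin N → Fin n₂
    index = remainder {n₁} n₂

  coronaAdj-↑ˡ-↑ˡ : ∀ i i' → C (i ↑ˡ N) (i' ↑ˡ N) ≡ adj G₁ i i'
  coronaAdj-↑ˡ-↑ˡ i i' rewrite FP.splitAt-↑ˡ n₁ i N | FP.splitAt-↑ˡ n₁ i' N = refl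

  coronaAdj-↑ˡ-↑ʳ : ∀ i y → C (i ↑ˡ N) (n₁ ↑ʳ y) ≡ (i == copy y)
  coronaAdj-↑ˡ-↑ʳ i y rewrite FP.splitAt-↑ˡ n₁ i N | FP.splitAt-↑ʳ n₁ N y = refl

  coronaAdj-↑ʳ-↑ˡ : ∀ x i' → C (n₁ ↑ʳ x) (i' ↑ˡ N) ≡ (copy x == i')
  coronaAdj-↑ʳ-↑ˡ x i' rewrite FP.splitAt-↑ʳ n₁ N x | FP.splitAt-↑ˡ n₁ i' N = refl

  coronaAdj-↑ʳ-↑ʳ : ∀ x y → C (n₁ ↑ʳ x) (n₁ ↑ʳ y) ≡ ((copy x == copy y) ∧ adj G₂ (index x) (index y))
  coronaAdj-↑ʳ-↑ʳ x y rewrite FP.splitAt-↑ʳ n₁ N x | FP.splitAt-↑ʳ n₁ N y = refl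

  degree-↑ˡ : ∀ i → degree C (i ↑ˡ N) ≡ degree (adj G₁) i + ℕtoℚ n₂
  degree-↑ˡ i = begin
    sumℚ (λ v → b2q (C (i ↑ˡ N) v))
      ≡⟨ sumℚ-↑ n₁ (λ v → b2q (C (i ↑ˡ N) v)) ⟩
    sumℚ (λ i' → b2q (C (i ↑ˡ N) (i' ↑ˡ N))) + sumℚ (λ y → b2q (C (i ↑ˡ N) (n₁ ↑ʳ y)))
      ≡⟨ cong₂ _+_ (sumℚ-cong (λ i' → cong b2q (coronaAdj-↑ˡ-↑ˡ i i')))
                   (sumℚ-cong (λ y → trans (cong b2q (trans (coronaAdj-↑ˡ-↑ʳ i y) (==-sym i (copy y)))) (b2q-if _))) ⟩
    degree (adj G₁) i + sumℚ (λ y → if copy y == i then 1ℚ else 0ℚ)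
      ≡⟨ cong (degree (adj G₁) i +_) (trans (sumℚ-quotient n₁ i (λ _ → 1ℚ)) (sumℚ-one n₂)) ⟩
    degree (adj G₁) i + ℕtoℚ n₂ ∎
    where open ≡-Reasoning

  degree-↑ʳ : ∀ x → degree C (n₁ ↑ʳ x) ≡ 1ℚ + degree (adj G₂) (index x)
  degree-↑ʳ x = begin
    sumℚ (λ v → b2q (C (n₁ ↑ʳ x) v))
      ≡⟨ sumℚ-↑ n₁ (λ v → b2q (C (n₁ ↑ʳ x) v)) ⟩
    sumℚ (λ i' → b2q (C (n₁ ↑ʳ x) (i' ↑ˡ N))) + sumℚ (λ y → b2q (C (n₁ ↑ʳ x) (n₁ ↑ʳ y)))
      ≡⟨ cong₂ _+_ (sumℚ-cong hub) (sumℚ-cong same-copy) ⟩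
    sumℚ (λ i' → if i' == copy x then 1ℚ else 0ℚ)
      + sumℚ (λ y → if copy y == copy x then b2q (adj G₂ (index x) (index y)) else 0ℚ)
      ≡⟨ cong₂ _+_ (sumℚ-delta (copy x) (λ _ → 1ℚ))
                   (sumℚ-quotient n₁ (copy x) (λ y → b2q (adj G₂ (index x) (index y)))) ⟩
    1ℚ + sumℚ (λ j → b2q (adj G₂ (index x) (index (combine (copy x) j))))
      ≡⟨ cong (1ℚ +_) (sumℚ-cong (λ j → cong (b2q ∘ adj G₂ (index x)) (remainder-combine (copy x) j))) ⟩
    1ℚ + degree (adj G₂) (index x) ∎
    where
      open ≡-Reasoning
      hub : ∀ i' → b2q (C (n₁ ↑ʳ x) (i' ↑ˡ N)) ≡ (if i' == copy x then 1ℚ else 0ℚ)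
      hub i' = trans (cong b2q (trans (coronaAdj-↑ʳ-↑ˡ x i') (==-sym (copy x) i'))) (b2q-if _)
      same-copy : ∀ y → b2q (C (n₁ ↑ʳ x) (n₁ ↑ʳ y)) ≡ (if copy y == copy x then b2q (adj G₂ (index x) (index y)) else 0ℚ)
      same-copy y = trans (cong b2q (trans (coronaAdj-↑ʳ-↑ʳ x y) (cong (_∧ adj G₂ (index x) (index y)) (==-sym (copy x) (copy y)))))
                          (b2q-∧ (copy y == copy x) _)

  module _ (λ' : ℚ) where

    private
      L : Matrix (n₁ ℕ.+ N)
      L = charMatrix (signlessLaplacian C) λ'

      P : Matrix n₂
      P = charMatrix (signlessLaplacian (adj G₂)) (λ' - 1ℚ)

    charMatrix-↑ˡ-↑ˡ : ∀ i i' → L (i ↑ˡ N) (i' ↑ˡ N) ≡ charMatrix (signlessLaplacian (adj G₁)) (λ' - ℕtoℚ n₂) i i'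
    charMatrix-↑ˡ-↑ˡ i i' rewrite ==-↑ˡ N i i' | coronaAdj-↑ˡ-↑ˡ i i' | degree-↑ˡ i with i == i'
    ... | true = solve 3 (λ l d n → l :- (d :+ n) := (l :- n) :- d) refl λ' (degree (adj G₁) i) (ℕtoℚ n₂)
    ... | false = refl

    charMatrix-↑ˡ-↑ʳ : ∀ i y → L (i ↑ˡ N) (n₁ ↑ʳ y) ≡ - b2q (i == copy y)
    charMatrix-↑ˡ-↑ʳ i y rewrite ==-≢ (↑ˡ≢↑ʳ {b = N} i y) | coronaAdj-↑ˡ-↑ʳ i y = QP.+-identityˡ _

    charMatrix-↑ʳ-↑ˡ : ∀ x i' → L (n₁ ↑ʳ x) (i' ↑ˡ N) ≡ - b2q (copy x == i')
    charMatrix-↑ʳ-↑ˡ x i' rewrite ==-≢ (↑ˡ≢↑ʳ {b = N} i' x ∘ sym) | coronaAdj-↑ʳ-↑ˡ x i' = QP.+-identityˡ _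

    charMatrix-↑ʳ-↑ʳ : ∀ x y → L (n₁ ↑ʳ x) (n₁ ↑ʳ y) ≡ blockDiagonal n₁ n₂ P x y
    charMatrix-↑ʳ-↑ʳ x y rewrite ==-↑ʳ n₁ x y | coronaAdj-↑ʳ-↑ʳ x y | degree-↑ʳ x with x F.≟ y
    ... | yes refl rewrite ==-refl (copy x) | ==-refl (index x) =
          solve 2 (λ l d → l :- (con 1ℚ :+ d) := (l :- con 1ℚ) :- d) refl λ' (degree (adj G₂) (index x))
    ... | no x≢y with copy x F.≟ copy y
    ...   | no _ = refl
    ...   | yes copy≡ rewrite ==-≢ (x≢y ∘ quotient-remainder-injective n₂ copy≡) = refl

    -- A Schur complement with respect to the block-diagonal part; w is 𝟙ᵀ P⁻¹.
    charPoly-corona : (w : Fin n₂ → ℚ) → (∀ l → sumℚ (λ j → w j * P j l) ≡ 1ℚ) →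
      charPoly (signlessLaplacian C) λ'
        ≡ charPoly (signlessLaplacian (adj G₁)) (λ' - ℕtoℚ n₂ - sumℚ w) * det P ^ℚ n₁
    charPoly-corona w wP≡𝟙 = begin
      det L
        ≡⟨ det-schurComplement n₁ L X upper-cancels ⟩
      det (λ i i' → L (i ↑ˡ N) (i' ↑ˡ N) + sumℚ (λ x → X i x * L (n₁ ↑ʳ x) (i' ↑ˡ N)))
        * det (λ x y → L (n₁ ↑ʳ x) (n₁ ↑ʳ y))
        ≡⟨ cong₂ _*_ (det-cong complement-entry) (trans (det-cong charMatrix-↑ʳ-↑ʳ) (det-blockDiagonal n₁ n₂ P)) ⟩
      charPoly (signlessLaplacian (adj G₁)) (λ' - ℕtoℚ n₂ - sumℚ w) * det P ^ℚ n₁ ∎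
      where
        open ≡-Reasoning
        X : Fin n₁ → Fin N → ℚ
        X i = onBlock n₁ i w
        upper-cancels : ∀ i y → L (i ↑ˡ N) (n₁ ↑ʳ y) + sumℚ (λ x → X i x * L (n₁ ↑ʳ x) (n₁ ↑ʳ y)) ≡ 0ℚ
        upper-cancels i y = begin
          L (i ↑ˡ N) (n₁ ↑ʳ y) + sumℚ (λ x → X i x * L (n₁ ↑ʳ x) (n₁ ↑ʳ y))
            ≡⟨ cong₂ _+_ (charMatrix-↑ˡ-↑ʳ i y) (sumℚ-cong (λ x → cong (X i x *_) (charMatrix-↑ʳ-↑ʳ x y))) ⟩
          - b2q (i == copy y) + sumℚ (λ x → X i x * blockDiagonal n₁ n₂ P x y)
            ≡⟨ cong (- b2q (i == copy y) +_) (sumℚ-onBlock-blockDiagonal n₁ P i w y) ⟩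
          - b2q (i == copy y) + (if i == copy y then sumℚ (λ j → w j * P j (index y)) else 0ℚ)
            ≡⟨ cancel (i == copy y) ⟩
          0ℚ ∎
          where
            cancel : ∀ e → - b2q e + (if e then sumℚ (λ j → w j * P j (index y)) else 0ℚ) ≡ 0ℚ
            cancel true = cong (- 1ℚ +_) (wP≡𝟙 (index y))
            cancel false = refl
        complement-entry : ∀ i i' → L (i ↑ˡ N) (i' ↑ˡ N) + sumℚ (λ x → X i x * L (n₁ ↑ʳ x) (i' ↑ˡ N))
                                    ≡ charMatrix (signlessLaplacian (adj G₁)) (λ' - ℕtoℚ n₂ - sumℚ w) i i'
        complement-entry i i' = begin
          L (i ↑ˡ N) (i' ↑ˡ N) + sumℚ (λ x → X i x * L (n₁ ↑ʳ x) (i' ↑ˡ N))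
            ≡⟨ cong₂ _+_ (charMatrix-↑ˡ-↑ˡ i i') (sumℚ-cong (λ x → cong (X i x *_) (charMatrix-↑ʳ-↑ˡ x i'))) ⟩
          charMatrix (signlessLaplacian (adj G₁)) (λ' - ℕtoℚ n₂) i i' + sumℚ (λ x → X i x * - b2q (copy x == i'))
            ≡⟨ cong (charMatrix (signlessLaplacian (adj G₁)) (λ' - ℕtoℚ n₂) i i' +_) (sumℚ-onBlock-quotient n₁ i w (λ q → - b2q (q == i'))) ⟩
          charMatrix (signlessLaplacian (adj G₁)) (λ' - ℕtoℚ n₂) i i' + (- b2q (i == i')) * sumℚ w
            ≡⟨ charMatrix-shift (signlessLaplacian (adj G₁)) (λ' - ℕtoℚ n₂) (sumℚ w) i i' ⟩
          charMatrix (signlessLaplacian (adj G₁)) (λ' - ℕtoℚ n₂ - sumℚ w) i i' ∎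

theorem2p11 : (n₁ n₂ : ℕ) (G₁ : SimpleGraph n₁) (G₂ : SimpleGraph n₂) →
    Connected G₁ → Connected G₂ →
    (λ' : ℚ) →
    (nz : charPoly (signlessLaplacian (adj G₂)) (λ' - 1ℚ) ≢ 0ℚ) →
    charPoly (signlessLaplacian (coronaAdj G₁ G₂)) λ'
      ≡ (charPoly (signlessLaplacian (adj G₂)) (λ' - 1ℚ) ^ℚ n₁)
        * charPoly (signlessLaplacian (adj G₁))
            (λ' - ℕtoℚ n₂ + 1ℚ
              - sign n₂ * divBy (charPoly (signlessLaplacian (complAdj G₂)) (ℕtoℚ n₂ - λ' - 1ℚ))
                                (charPoly (signlessLaplacian (adj G₂)) (λ' - 1ℚ)) nz)
theorem2p11 n₁ n₂ G₁ G₂ _ _ λ' nz = begin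
  charPoly (signlessLaplacian (coronaAdj G₁ G₂)) λ'
    ≡⟨ Corona.charPoly-corona G₁ G₂ λ' w (inverseColumnSums-* P nz) ⟩
  charPoly Q₁ (λ' - ℕtoℚ n₂ - sumℚ w) * p ^ℚ n₁
    ≡⟨ QP.*-comm _ (p ^ℚ n₁) ⟩
  p ^ℚ n₁ * charPoly Q₁ (λ' - ℕtoℚ n₂ - sumℚ w)
    ≡⟨ cong (λ μ → p ^ℚ n₁ * charPoly Q₁ μ) (sym shift≡) ⟩
  p ^ℚ n₁ * charPoly Q₁ (λ' - ℕtoℚ n₂ + 1ℚ - sign n₂ * divBy f̄ p nz) ∎
  where
    open ≡-Reasoning
    Q₁ : Matrix n₁
    Q₁ = signlessLaplacian (adj G₁)
    P : Matrix n₂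
    P = charMatrix (signlessLaplacian (adj G₂)) (λ' - 1ℚ)
    p f̄ : ℚ
    p = det P
    f̄ = charPoly (signlessLaplacian (complAdj G₂)) (ℕtoℚ n₂ - λ' - 1ℚ)
    w : Fin n₂ → ℚ
    w = inverseColumnSums P nz
    shift≡ : λ' - ℕtoℚ n₂ + 1ℚ - sign n₂ * divBy f̄ p nz ≡ λ' - ℕtoℚ n₂ - sumℚ w
    shift≡ = begin
      λ' - ℕtoℚ n₂ + 1ℚ - sign n₂ * divBy f̄ p nz
        ≡⟨ cong (λ z → λ' - ℕtoℚ n₂ + 1ℚ - z) (divBy-charPoly-complAdj G₂ λ' nz) ⟩
      λ' - ℕtoℚ n₂ + 1ℚ - (1ℚ + divBy (sumAdjugate P) p nz)
        ≡⟨ cong (λ z → λ' - ℕtoℚ n₂ + 1ℚ - (1ℚ + z)) (sym (sumℚ-inverseColumnSums P nz)) ⟩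
      λ' - ℕtoℚ n₂ + 1ℚ - (1ℚ + sumℚ w)
        ≡⟨ solve 3 (λ l n s → l :- n :+ con 1ℚ :- (con 1ℚ :+ s) := l :- n :- s) refl λ' (ℕtoℚ n₂) (sumℚ w) ⟩
      λ' - ℕtoℚ n₂ - sumℚ w ∎
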